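{- Let $\mathcal{X}=\{R_1,\ldots,R_k\}$ be a collection of strings over the DNA alphabet and let $\mathcal{R}=\{R_1\$,\hat R_1\$,\ldots,R_k\$,\hat R_k\$\}$. Let $X$ be a string over $\Sigma$ that occurs as a substring in $\mathcal{R}$, let $[s_X,e_X]$ be the range of the suffix array $S\!A$ of $\mathcal{R}$ containing exactly the suffixes prefixed by $X$, and let $[s_{\hat X},e_{\hat X}]$ be the range of $S\!A$ containing exactly the suffixes prefixed by $\hat X$. Then the sorted sequence of the symbols $\pi(BWT[t])$, $t\in[s_X,e_X]$, equals the sorted sequence of the right-context symbols of the occurrences of $\hat X$ in $\mathcal{R}$ (i.e., the symbols immediately following each occurrence of $\hat X$). Symmetrically, the sorted sequence of the symbols $\pi(BWT[t])$, $t\in[s_{\hat X},e_{\hat X}]$, equals the sorted sequence of the right-context symbols of the occurrences of $X$ in $\mathcal{R}$.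
   Context: The DNA alphabet $\{\texttt{A},\texttt{C},\texttt{G},\texttt{T}\}$ is identified with $\{2,3,4,5\}$, and $\Sigma=\{1,\ldots,5\}$ where $1=\$$ is a sentinel smaller than all other symbols. The complement $\pi$ is the permutation of $\Sigma$ exchanging $2\leftrightarrow 5$ (A,T), $3\leftrightarrow 4$ (C,G), and fixing $1$. For a string $R$, its reverse complement $\hat R$ is obtained by reversing $R$ and replacing each symbol $a$ by $\pi(a)$. The suffix array $S\!A$ of the collection $\mathcal{R}$ lists all suffixes of the strings of $\mathcal{R}$ in increasing lexicographic order, and $BWT[t]$ is the symbol preceding the $t$-th suffix (the BWT of a string collection in the BCR variant; the symbol preceding a suffix that starts a string is a sentinel $\$$). The right-context symbol of an occurrence of a string $Y$ is the symbol of $\mathcal{R}$ immediately after that occurrence. -}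

module Defs where

open import Data.Nat using (ℕ; zero; suc; _+_; _≤_; _≤?_)
open import Data.Fin using (Fin; toℕ) renaming (zero to fzero; suc to fsuc)
open import Data.Fin.Properties using (≤-decTotalOrder)
open import Data.List using (List; []; _∷_; _++_; [_]; reverse; map; concatMap; length; lookup; drop; allFin; filter)
open import Data.List.Relation.Unary.All using (All)
open import Data.List.Relation.Unary.Linked using (Linked)
open import Data.List.Relation.Binary.Permutation.Propositional using (_↭_)
open import Data.Product using (Σ; ∃; _×_; _,_)
open import Relation.Binary.PropositionalEquality using (_≡_; _≢_)
open import Relation.Nullary using (Dec; yes; no; ¬_)
open import Relation.Nullary.Decidable using (_×-dec_)
import Data.List.Sort

-- Alphabet Σ = {1,...,5}, encoded as Fin 5 via  k ↦ k-1 :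
--   $ = 1 ↦ 0,  A = 2 ↦ 1,  C = 3 ↦ 2,  G = 4 ↦ 3,  T = 5 ↦ 4.
-- The natural order of Fin 5 is the order of Σ ($ smallest).

Sym : Set
Sym = Fin 5

pattern $ = fzero
pattern A = fsuc fzero
pattern C = fsuc (fsuc fzero)
pattern G = fsuc (fsuc (fsuc fzero))
pattern T = fsuc (fsuc (fsuc (fsuc fzero)))

π : Sym → Sym
π $ = $
π A = T
π C = G
π G = C
π T = A

IsDNA : Sym → Set
IsDNA x = x ≢ $

DNAString : List Sym → Set
DNAString = All IsDNA

revcomp : List Sym → List Sym
revcomp R = reverse (map π R)

collection : List (List Sym) → List (List Sym)
collection 𝓧 = concatMap (λ R → (R ++ [ $ ]) ∷ (revcomp R ++ [ $ ]) ∷ []) 𝓧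

Pos : List (List Sym) → Set
Pos 𝓡 = Σ (Fin (length 𝓡)) λ i → Fin (length (lookup 𝓡 i))

allPos : (𝓡 : List (List Sym)) → List (Pos 𝓡)
allPos 𝓡 = concatMap (λ i → map (λ j → (i , j)) (allFin (length (lookup 𝓡 i)))) (allFin (length 𝓡))

suffix : (𝓡 : List (List Sym)) → Pos 𝓡 → List Sym
suffix 𝓡 (i , j) = drop (toℕ j) (lookup 𝓡 i)

-- symbol at index n of a string ($ as a default outside the string;
-- only used at in-range indices below)
symAt : List Sym → ℕ → Sym
symAt []       n       = $
symAt (x ∷ xs) zero    = x
symAt (x ∷ xs) (suc n) = symAt xs n

-- BWT symbol of a suffix: the preceding symbol, or $ if the suffix
-- starts its string (BCR variant)
bwtSym : (𝓡 : List (List Sym)) → Pos 𝓡 → Sym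
bwtSym 𝓡 (i , j) with toℕ j
... | zero  = $
... | suc m = symAt (lookup 𝓡 i) m

data _≤lex_ : List Sym → List Sym → Set where
  []≤    : ∀ {ys} → [] ≤lex ys
  head<  : ∀ {x y xs ys} → toℕ x Data.Nat.< toℕ y → (x ∷ xs) ≤lex (y ∷ ys)
  head≡  : ∀ {x xs ys} → xs ≤lex ys → (x ∷ xs) ≤lex (x ∷ ys)

IsSuffixArray : (𝓡 : List (List Sym)) → List (Pos 𝓡) → Set
IsSuffixArray 𝓡 SA =
  (SA ↭ allPos 𝓡) × Linked (λ p q → suffix 𝓡 p ≤lex suffix 𝓡 q) SA

_IsPrefixOf_ : List Sym → List Sym → Set
X IsPrefixOf w = ∃ λ rest → X ++ rest ≡ w

prefix? : (X w : List Sym) → Dec (X IsPrefixOf w)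
prefix? [] w = yes (w , Relation.Binary.PropositionalEquality.refl)
prefix? (x ∷ X) [] = no λ { (_ , ()) }
prefix? (x ∷ X) (y ∷ w) with x Data.Fin.≟ y | prefix? X w
... | yes Relation.Binary.PropositionalEquality.refl | yes (r , Relation.Binary.PropositionalEquality.refl) =
  yes (r , Relation.Binary.PropositionalEquality.refl)
... | yes Relation.Binary.PropositionalEquality.refl | no ¬p = no λ { (r , Relation.Binary.PropositionalEquality.refl) → ¬p (r , Relation.Binary.PropositionalEquality.refl) }
... | no x≢y | _ = no λ { (r , Relation.Binary.PropositionalEquality.refl) → x≢y Relation.Binary.PropositionalEquality.refl }

Occurs : (𝓡 : List (List Sym)) → List Sym → Set
Occurs 𝓡 X = Σ (Pos 𝓡) λ p → X IsPrefixOf suffix 𝓡 p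

IsRange : (𝓡 : List (List Sym)) → List (Pos 𝓡) → List Sym → ℕ → ℕ → Set
IsRange 𝓡 SA X s e = (t : Fin (length SA)) →
  ((s ≤ toℕ t × toℕ t ≤ e) → X IsPrefixOf suffix 𝓡 (lookup SA t)) ×
  (X IsPrefixOf suffix 𝓡 (lookup SA t) → (s ≤ toℕ t × toℕ t ≤ e))

πBWTRange : (𝓡 : List (List Sym)) → List (Pos 𝓡) → ℕ → ℕ → List Sym
πBWTRange 𝓡 SA s e =
  map (λ t → π (bwtSym 𝓡 (lookup SA t)))
      (filter (λ t → (s ≤? toℕ t) ×-dec (toℕ t ≤? e)) (allFin (length SA)))

rightContexts : (𝓡 : List (List Sym)) → List Sym → List Sym
rightContexts 𝓡 X =
  map (λ { (i , j) → symAt (lookup 𝓡 i) (toℕ j + length X) })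
      (filter (λ p → prefix? X (suffix 𝓡 p)) (allPos 𝓡))

sortSyms : List Sym → List Sym
sortSyms = Data.List.Sort.sort (≤-decTotalOrder 5)

{-# OPTIONS --safe #-}
module Submission where

-- Read backwards and complemented, R$ becomes R̂$, and an occurrence of X in R$ preceded by
-- the symbol x becomes an occurrence of X̂ in R̂$ followed by π x, at the mirrored position.
-- So the π(BWT) symbols at the occurrences of X in R$ are, in reverse order, the right
-- contexts of X̂ in R̂$: the occurrence at the start of R$, whose BWT symbol is $, matches the
-- occurrence of X̂ just before the final $ of R̂$, and since X is DNA no occurrence runs into
-- a $. Summing over the pairs R$, R̂$ gives equality as multisets, and the SA range of X lists
-- every occurrence of X exactly once.

open import Defs
open import Data.Nat using (ℕ; zero; suc; _+_; _≤_; _<_; _≤?_)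
open import Data.Nat.Properties using (<⇒≤; <⇒≱; ≤-refl; ≤-pred; m≤n+m)
open import Data.Fin using (toℕ; _≟_)
open import Data.Fin.Properties using (≤-decTotalOrder)
open import Data.List
  using (List; []; _∷_; _++_; [_]; reverse; map; concatMap; length; lookup; drop; allFin;
         filter; upTo; applyUpTo; tabulate; fromMaybe)
open import Data.List.Properties
  using (≡-dec; map-++; map-∘; map-cong; map-id; map-tabulate; tabulate-lookup; map-upTo;
         reverse-++; reverse-map; reverse-involutive; unfold-reverse; ++-assoc; ++-identityʳ;
         length-++; filter-++; filter-≐; concatMap-cong; concatMap-map; map-concatMap;
         ∷-injectiveˡ; ∷-injectiveʳ)
open import Data.List.Relation.Unary.All using (All; []; _∷_)
open import Data.List.Relation.Unary.All.Properties using (++⁻ʳ; ∷ʳ⁺)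
open import Data.List.Relation.Binary.Permutation.Propositional
  using (_↭_; ↭-refl; ↭-sym; ↭-trans; ↭-reflexive; ↭⇒↭ₛ; module PermutationReasoning)
open import Data.List.Relation.Binary.Permutation.Propositional.Properties
  using (map⁺; filter-↭; ++⁺; shifts; ↭-reverse)
open import Data.List.Relation.Binary.Pointwise using (Pointwise-≡⇒≡)
import Data.List.Relation.Unary.Sorted.TotalOrder.Properties as Sorted
import Data.List.Sort
open import Data.Maybe using (Maybe; just; nothing)
open import Data.Product using (_×_; _,_; proj₁; proj₂; ∃)
open import Data.Bool using (true; false; if_then_else_)
open import Data.Empty using (⊥-elim)
open import Function using (_∘_; id)
open import Function.Bundles using (_⇔_; mk⇔; Equivalence)
open import Relation.Binary.Bundles using (DecTotalOrder)
open import Relation.Binary.PropositionalEquality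
  using (_≡_; _≢_; refl; sym; trans; cong; cong₂; subst; module ≡-Reasoning)
open import Relation.Nullary using (Dec; yes; no; does; ¬_)
open import Relation.Nullary.Decidable using (dec-false; _×-dec_)

sortSyms-↭ : {xs ys : List Sym} → xs ↭ ys → sortSyms xs ≡ sortSyms ys
sortSyms-↭ {xs} {ys} xs↭ys =
  Pointwise-≡⇒≡ (Sorted.↗↭↗⇒≋ totalOrder (sort-↗ xs) (sort-↗ ys)
    (↭⇒↭ₛ (↭-trans (sort-↭ xs) (↭-trans xs↭ys (↭-sym (sort-↭ ys))))))
  where
  open DecTotalOrder (≤-decTotalOrder 5) using (totalOrder)
  open Data.List.Sort (≤-decTotalOrder 5) using (sort-↭; sort-↗)

map-filter-map : {B C D : Set} {P : C → Set} (g : C → D) (P? : ∀ c → Dec (P c)) (h : B → C)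
                 (xs : List B) →
                 map g (filter P? (map h xs)) ≡ map (g ∘ h) (filter (P? ∘ h) xs)
map-filter-map g P? h []       = refl
map-filter-map g P? h (x ∷ xs) with does (P? (h x))
... | true  = cong (g (h x) ∷_) (map-filter-map g P? h xs)
... | false = map-filter-map g P? h xs

filter-concatMap : {B C : Set} {P : C → Set} (P? : ∀ c → Dec (P c)) (f : B → List C)
                   (xs : List B) →
                   filter P? (concatMap f xs) ≡ concatMap (filter P? ∘ f) xs
filter-concatMap P? f []       = refl
filter-concatMap P? f (x ∷ xs) =
  trans (filter-++ P? (f x) (concatMap f xs)) (cong (filter P? (f x) ++_) (filter-concatMap P? f xs))

map-lookup-allFin : {B : Set} (xs : List B) → map (lookup xs) (allFin (length xs)) ≡ xs
map-lookup-allFin xs = trans (map-tabulate id (lookup xs)) (tabulate-lookup xs)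

map-toℕ-allFin : ∀ n → map toℕ (allFin n) ≡ upTo n
map-toℕ-allFin n = trans (map-tabulate id toℕ) (tabulate-∘toℕ id n)
  where
  tabulate-∘toℕ : {B : Set} (f : ℕ → B) (n : ℕ) → tabulate (f ∘ toℕ {n}) ≡ applyUpTo f n
  tabulate-∘toℕ f zero    = refl
  tabulate-∘toℕ f (suc n) = cong (f 0 ∷_) (tabulate-∘toℕ (f ∘ suc) n)

when? : {P B : Set} → Dec P → B → List B
when? p? x = if does p? then [ x ] else []

when?-⇔ : {P Q B : Set} → P ⇔ Q → (p? : Dec P) (q? : Dec Q) (x : B) → when? p? x ≡ when? q? x
when?-⇔ _   (yes _) (yes _) _ = refl
when?-⇔ _   (no _)  (no _)  _ = refl
when?-⇔ P⇔Q (yes p) (no ¬q) _ = ⊥-elim (¬q (Equivalence.to P⇔Q p))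
when?-⇔ P⇔Q (no ¬p) (yes q) _ = ⊥-elim (¬p (Equivalence.from P⇔Q q))

map-when? : {P B C : Set} (f : B → C) (p? : Dec P) (x : B) → map f (when? p? x) ≡ when? p? (f x)
map-when? f (yes _) x = refl
map-when? f (no _)  x = refl

reverse-when? : {P B : Set} (p? : Dec P) (x : B) → reverse (when? p? x) ≡ when? p? x
reverse-when? (yes _) x = refl
reverse-when? (no _)  x = refl

π-involutive : ∀ x → π (π x) ≡ x
π-involutive $ = refl
π-involutive A = refl
π-involutive C = refl
π-involutive G = refl
π-involutive T = refl

π-DNA : ∀ {x} → IsDNA x → IsDNA (π x)
π-DNA {$} x≢$ = x≢$
π-DNA {A} _ ()
π-DNA {C} _ ()
π-DNA {G} _ ()
π-DNA {T} _ ()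

revcomp-∷ : ∀ x u → revcomp (x ∷ u) ≡ revcomp u ++ [ π x ]
revcomp-∷ x u = unfold-reverse (π x) (map π u)

revcomp-++ : ∀ u v → revcomp (u ++ v) ≡ revcomp v ++ revcomp u
revcomp-++ u v = trans (cong reverse (map-++ π u v)) (reverse-++ (map π u) (map π v))

revcomp-involutive : ∀ u → revcomp (revcomp u) ≡ u
revcomp-involutive u = begin
  reverse (map π (reverse (map π u))) ≡⟨ cong reverse (reverse-map π (map π u)) ⟩
  reverse (reverse (map π (map π u))) ≡⟨ reverse-involutive (map π (map π u)) ⟩
  map π (map π u)                     ≡⟨ map-∘ u ⟨
  map (π ∘ π) u                       ≡⟨ map-cong π-involutive u ⟩
  map id u                            ≡⟨ map-id u ⟩
  u                                   ∎
  where open ≡-Reasoning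

revcomp-DNA : ∀ {u} → DNAString u → DNAString (revcomp u)
revcomp-DNA {[]}    []            = []
revcomp-DNA {x ∷ u} (x≢$ ∷ u-dna) =
  subst DNAString (sym (revcomp-∷ x u)) (∷ʳ⁺ (revcomp-DNA u-dna) (π-DNA x≢$))

DNA-≢-∷ʳ$ : ∀ {Y} → DNAString Y → ∀ u → Y ≢ u ++ [ $ ]
DNA-≢-∷ʳ$ Y-dna u refl with ++⁻ʳ u Y-dna
... | $≢$ ∷ [] = $≢$ refl

prefix-∷ʳ-$ : ∀ {Y} → DNAString Y → ∀ u → Y IsPrefixOf (u ++ [ $ ]) ⇔ Y IsPrefixOf u
prefix-∷ʳ-$ {Y} Y-dna u = mk⇔ (to Y-dna u) (λ (r , p) → r ++ [ $ ] , from p)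
  where
  to : ∀ {Y} → DNAString Y → ∀ u → Y IsPrefixOf (u ++ [ $ ]) → Y IsPrefixOf u
  to []            u       _       = u , refl
  to (y≢$ ∷ _)     []      (_ , p) = ⊥-elim (y≢$ (∷-injectiveˡ p))
  to (_ ∷ Y-dna)   (x ∷ u) (r , p) with refl ← ∷-injectiveˡ p
    with r′ , p′ ← to Y-dna u (r , ∷-injectiveʳ p) = r′ , cong (x ∷_) p′
  from : ∀ {r} → Y ++ r ≡ u → Y ++ r ++ [ $ ] ≡ u ++ [ $ ]
  from {r} p = trans (sym (++-assoc Y r [ $ ])) (cong (_++ [ $ ]) p)

_IsSuffixOf_ : List Sym → List Sym → Set
Z IsSuffixOf v = ∃ λ P → P ++ Z ≡ v

_≟ₗ_ : (u v : List Sym) → Dec (u ≡ v)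
_≟ₗ_ = ≡-dec _≟_

suffix? : (Z v : List Sym) → Dec (Z IsSuffixOf v)
suffix? Z [] with Z ≟ₗ []
... | yes Z≡[] = yes ([] , Z≡[])
... | no  Z≢[] = no λ { ([] , p) → Z≢[] p }
suffix? Z (x ∷ v) with Z ≟ₗ (x ∷ v)
... | yes Z≡xv = yes ([] , Z≡xv)
... | no  Z≢xv with suffix? Z v
...   | yes (P , p) = yes (x ∷ P , cong (x ∷_) p)
...   | no  ¬suf    = no λ { ([] , p) → Z≢xv p ; (_ ∷ P , p) → ¬suf (P , ∷-injectiveʳ p) }

¬suffix-shorter : ∀ Z v → length v < length Z → ¬ Z IsSuffixOf v
¬suffix-shorter Z v v<Z (P , refl) =
  <⇒≱ v<Z (subst (length Z ≤_) (sym (length-++ P)) (m≤n+m (length Z) (length P)))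

prefix⇔suffix-revcomp : ∀ {Y u} → Y IsPrefixOf u ⇔ revcomp Y IsSuffixOf revcomp u
prefix⇔suffix-revcomp {Y} {u} = mk⇔
  (λ (r , p) → revcomp r , trans (sym (revcomp-++ Y r)) (cong revcomp p))
  (λ (P , p) → revcomp P , (begin
    Y ++ revcomp P                     ≡⟨ cong (_++ revcomp P) (revcomp-involutive Y) ⟨
    revcomp (revcomp Y) ++ revcomp P   ≡⟨ revcomp-++ P (revcomp Y) ⟨
    revcomp (P ++ revcomp Y)           ≡⟨ cong revcomp p ⟩
    revcomp (revcomp u)                ≡⟨ revcomp-involutive u ⟩
    u                                  ∎))
  where open ≡-Reasoning

after : List Sym → List Sym → Maybe Sym
after []      []      = nothing
after []      (y ∷ _) = just y
after (_ ∷ _) []      = nothing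
after (z ∷ Z) (x ∷ s) with z ≟ x
... | yes _ = after Z s
... | no  _ = nothing

after-[] : ∀ Z → after Z [] ≡ nothing
after-[] []      = refl
after-[] (_ ∷ _) = refl

after-++-∷ : ∀ Z y r → after Z (Z ++ y ∷ r) ≡ just y
after-++-∷ []      y r = refl
after-++-∷ (z ∷ Z) y r with z ≟ z
... | yes _   = after-++-∷ Z y r
... | no  z≢z = ⊥-elim (z≢z refl)

after-shorter : ∀ Z s → length s ≤ length Z → after Z s ≡ nothing
after-shorter []      []      _ = refl
after-shorter (_ ∷ _) []      _ = refl
after-shorter (z ∷ Z) (x ∷ s) s≤Z with z ≟ x
... | yes _ = after-shorter Z s (≤-pred s≤Z)
... | no  _ = refl

after-∷ʳ-≢ : ∀ Z s b → Z ≢ s → after Z (s ++ [ b ]) ≡ after Z s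
after-∷ʳ-≢ []      []      b Z≢s = ⊥-elim (Z≢s refl)
after-∷ʳ-≢ []      (_ ∷ _) b _   = refl
after-∷ʳ-≢ (z ∷ Z) []      b _   with z ≟ b
... | yes _ = after-[] Z
... | no  _ = refl
after-∷ʳ-≢ (z ∷ Z) (x ∷ s) b Z≢s with z ≟ x
... | yes refl = after-∷ʳ-≢ Z s b (Z≢s ∘ cong (z ∷_))
... | no  _    = refl

after-just⇒prefix : ∀ Z s {y} → after Z s ≡ just y → Z IsPrefixOf s
after-just⇒prefix []      s       _ = s , refl
after-just⇒prefix (z ∷ Z) (x ∷ s) eq with z ≟ x
... | yes refl with r , p ← after-just⇒prefix Z s eq = r , cong (z ∷_) p

symAt-++-∷ : ∀ Z y r → symAt (Z ++ y ∷ r) (length Z) ≡ y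
symAt-++-∷ []      y r = refl
symAt-++-∷ (_ ∷ Z) y r = symAt-++-∷ Z y r

after-∷ʳ-$ : ∀ {Z} → DNAString Z → ∀ V →
  fromMaybe (after Z (V ++ [ $ ])) ≡ when? (prefix? Z (V ++ [ $ ])) (symAt (V ++ [ $ ]) (length Z))
after-∷ʳ-$ {Z} Z-dna V with prefix? Z (V ++ [ $ ])
... | yes ([] , p)    = ⊥-elim (DNA-≢-∷ʳ$ Z-dna V (trans (sym (++-identityʳ Z)) p))
... | yes (y ∷ r , p) rewrite sym p =
  trans (cong fromMaybe (after-++-∷ Z y r)) (cong [_] (sym (symAt-++-∷ Z y r)))
... | no ¬prefix with after Z (V ++ [ $ ]) in eq
...   | nothing = refl
...   | just _  = ⊥-elim (¬prefix (after-just⇒prefix Z (V ++ [ $ ]) eq))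

-- Only occurrences actually followed by a symbol contribute, which makes followers-∷ʳ exact.
followers : List Sym → List Sym → List Sym
followers Z []      = []
followers Z (x ∷ s) = fromMaybe (after Z (x ∷ s)) ++ followers Z s

followers-shorter : ∀ Z s → length s ≤ length Z → followers Z s ≡ []
followers-shorter Z []      _   = refl
followers-shorter Z (x ∷ s) xs≤Z
  rewrite after-shorter Z (x ∷ s) xs≤Z = followers-shorter Z s (<⇒≤ xs≤Z)

followers-∷ʳ : ∀ Z v b → followers Z (v ++ [ b ]) ≡ followers Z v ++ when? (suffix? Z v) b
followers-∷ʳ Z [] b with Z ≟ₗ []
... | yes refl = refl
... | no  Z≢[] = cong (λ m → fromMaybe m ++ []) (trans (after-∷ʳ-≢ Z [] b Z≢[]) (after-[] Z))
followers-∷ʳ Z (x ∷ v) b with Z ≟ₗ (x ∷ v)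
... | yes refl
  rewrite after-++-∷ (x ∷ v) b []
        | after-shorter (x ∷ v) (x ∷ v) ≤-refl
        | followers-∷ʳ (x ∷ v) v b
        | followers-shorter (x ∷ v) v (<⇒≤ ≤-refl)
        | dec-false (suffix? (x ∷ v) v) (¬suffix-shorter (x ∷ v) v ≤-refl) = refl
... | no  Z≢xv
  rewrite after-∷ʳ-≢ Z (x ∷ v) b Z≢xv
        | followers-∷ʳ Z v b with suffix? Z v
...   | yes _ = sym (++-assoc (fromMaybe (after Z (x ∷ v))) (followers Z v) [ b ])
...   | no  _ = sym (++-assoc (fromMaybe (after Z (x ∷ v))) (followers Z v) [])

preceders : List Sym → List Sym → List Sym
preceders Y []      = []
preceders Y (x ∷ u) = when? (prefix? Y u) x ++ preceders Y u

map-π-preceders : ∀ Y w → map π (preceders Y w) ≡ reverse (followers (revcomp Y) (revcomp w))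
map-π-preceders Y []      = refl
map-π-preceders Y (x ∷ u) = begin
  map π (when? (prefix? Y u) x ++ preceders Y u)
    ≡⟨ map-++ π (when? (prefix? Y u) x) (preceders Y u) ⟩
  map π (when? (prefix? Y u) x) ++ map π (preceders Y u)
    ≡⟨ cong₂ _++_ (map-when? π (prefix? Y u) x) (map-π-preceders Y u) ⟩
  when? (prefix? Y u) (π x) ++ reverse (followers Ŷ û)
    ≡⟨ cong (_++ reverse (followers Ŷ û))
         (trans (when?-⇔ prefix⇔suffix-revcomp (prefix? Y u) (suffix? Ŷ û) (π x))
                (sym (reverse-when? (suffix? Ŷ û) (π x)))) ⟩
  reverse (when? (suffix? Ŷ û) (π x)) ++ reverse (followers Ŷ û)
    ≡⟨ reverse-++ (followers Ŷ û) (when? (suffix? Ŷ û) (π x)) ⟨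
  reverse (followers Ŷ û ++ when? (suffix? Ŷ û) (π x))
    ≡⟨ cong reverse (followers-∷ʳ Ŷ û (π x)) ⟨
  reverse (followers Ŷ (û ++ [ π x ]))
    ≡⟨ cong (reverse ∘ followers Ŷ) (revcomp-∷ x u) ⟨
  reverse (followers Ŷ (revcomp (x ∷ u))) ∎
  where
  open ≡-Reasoning
  Ŷ = revcomp Y
  û = revcomp u

mapOccurrences : {B : Set} → List Sym → List Sym → (ℕ → B) → List B
mapOccurrences Y w f = map f (filter (λ n → prefix? Y (drop n w)) (upTo (length w)))

mapOccurrences-∷ : {B : Set} (Y : List Sym) (x : Sym) (u : List Sym) (f : ℕ → B) →
  mapOccurrences Y (x ∷ u) f ≡ when? (prefix? Y (x ∷ u)) (f 0) ++ mapOccurrences Y u (f ∘ suc)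
mapOccurrences-∷ Y x u f = split
  where
  shift : map f (filter (λ n → prefix? Y (drop n (x ∷ u))) (applyUpTo suc (length u)))
          ≡ mapOccurrences Y u (f ∘ suc)
  shift = trans (cong (map f ∘ filter _) (sym (map-upTo suc (length u))))
                (map-filter-map f _ suc (upTo (length u)))
  split : mapOccurrences Y (x ∷ u) f
          ≡ when? (prefix? Y (x ∷ u)) (f 0) ++ mapOccurrences Y u (f ∘ suc)
  split with does (prefix? Y (x ∷ u))
  ... | true  = cong (f 0 ∷_) shift
  ... | false = shift

mapOccurrences-cong : {B : Set} (Y w : List Sym) {f g : ℕ → B} → (∀ n → f n ≡ g n) →
                      mapOccurrences Y w f ≡ mapOccurrences Y w g
mapOccurrences-cong Y w f≗g = map-cong f≗g _

precedingSym : Sym → List Sym → ℕ → Sym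
precedingSym c u zero    = c
precedingSym c u (suc n) = symAt u n

precedingSym-∷ : ∀ c x u n → precedingSym c (x ∷ u) (suc n) ≡ precedingSym x u n
precedingSym-∷ c x u zero    = refl
precedingSym-∷ c x u (suc n) = refl

-- The occurrence at the final $ (possible only for Y = []) is the one at the end of u.
mapOccurrences-preceders : ∀ {Y} → DNAString Y → ∀ c u →
  mapOccurrences Y (u ++ [ $ ]) (precedingSym c (u ++ [ $ ])) ≡ preceders Y (c ∷ u)
mapOccurrences-preceders {Y} Y-dna c [] = trans (mapOccurrences-∷ Y $ [] _)
  (cong (_++ []) (when?-⇔ (prefix-∷ʳ-$ Y-dna []) (prefix? Y [ $ ]) (prefix? Y []) c))
mapOccurrences-preceders {Y} Y-dna c (x ∷ u) = begin
  mapOccurrences Y (x ∷ w) (precedingSym c (x ∷ w))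
    ≡⟨ mapOccurrences-∷ Y x w _ ⟩
  when? (prefix? Y (x ∷ w)) c ++ mapOccurrences Y w (precedingSym c (x ∷ w) ∘ suc)
    ≡⟨ cong₂ _++_ (when?-⇔ (prefix-∷ʳ-$ Y-dna (x ∷ u)) (prefix? Y (x ∷ w)) (prefix? Y (x ∷ u)) c)
                  (trans (mapOccurrences-cong Y w (precedingSym-∷ c x w))
                         (mapOccurrences-preceders Y-dna x u)) ⟩
  when? (prefix? Y (x ∷ u)) c ++ preceders Y (x ∷ u) ∎
  where
  open ≡-Reasoning
  w = u ++ [ $ ]

mapOccurrences-followers : ∀ {Z} → DNAString Z → ∀ V →
  mapOccurrences Z (V ++ [ $ ]) (λ n → symAt (V ++ [ $ ]) (n + length Z)) ≡ followers Z (V ++ [ $ ])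
mapOccurrences-followers {Z} Z-dna [] =
  trans (mapOccurrences-∷ Z $ [] _) (cong (_++ []) (sym (after-∷ʳ-$ Z-dna [])))
mapOccurrences-followers {Z} Z-dna (x ∷ V) =
  trans (mapOccurrences-∷ Z x (V ++ [ $ ]) _)
        (cong₂ _++_ (sym (after-∷ʳ-$ Z-dna (x ∷ V))) (mapOccurrences-followers Z-dna V))

πBWTsIn : List Sym → List Sym → List Sym
πBWTsIn Y w = mapOccurrences Y w (π ∘ precedingSym $ w)

rightContextsIn : List Sym → List Sym → List Sym
rightContextsIn Z w = mapOccurrences Z w (λ n → symAt w (n + length Z))

πBWTsIn-reverse-rightContextsIn : ∀ {Y} → DNAString Y → ∀ R →
  πBWTsIn Y (R ++ [ $ ]) ≡ reverse (rightContextsIn (revcomp Y) (revcomp R ++ [ $ ]))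
πBWTsIn-reverse-rightContextsIn {Y} Y-dna R = begin
  mapOccurrences Y w (π ∘ precedingSym $ w)
    ≡⟨ map-∘ _ ⟩
  map π (mapOccurrences Y w (precedingSym $ w))
    ≡⟨ cong (map π) (mapOccurrences-preceders Y-dna $ R) ⟩
  map π (preceders Y ($ ∷ R))
    ≡⟨ map-π-preceders Y ($ ∷ R) ⟩
  reverse (followers Ŷ (revcomp ($ ∷ R)))
    ≡⟨ cong (reverse ∘ followers Ŷ) (revcomp-∷ $ R) ⟩
  reverse (followers Ŷ (revcomp R ++ [ $ ]))
    ≡⟨ cong reverse (mapOccurrences-followers (revcomp-DNA Y-dna) (revcomp R)) ⟨
  reverse (rightContextsIn Ŷ (revcomp R ++ [ $ ])) ∎
  where
  open ≡-Reasoning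
  w = R ++ [ $ ]
  Ŷ = revcomp Y

concatMap-collection-↭ : {B : Set} {f g : List Sym → List B} →
  (∀ R → f (R ++ [ $ ]) ↭ g (revcomp R ++ [ $ ])) →
  ∀ 𝓧 → concatMap f (collection 𝓧) ↭ concatMap g (collection 𝓧)
concatMap-collection-↭ f↭g []      = ↭-refl
concatMap-collection-↭ {f = f} {g} f↭g (R ∷ 𝓧) =
  ↭-trans (++⁺ (f↭g R) (++⁺ f↭g′ (concatMap-collection-↭ f↭g 𝓧)))
          (shifts (g (revcomp R ++ [ $ ])) (g (R ++ [ $ ])))
  where
  f↭g′ : f (revcomp R ++ [ $ ]) ↭ g (R ++ [ $ ])
  f↭g′ = subst (λ v → f (revcomp R ++ [ $ ]) ↭ g (v ++ [ $ ]))
               (revcomp-involutive R) (f↭g (revcomp R))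

map-filter-allPos : {B : Set} (𝓡 : List (List Sym)) {P : List Sym → ℕ → Set}
  (P? : ∀ w n → Dec (P w n)) (f : List Sym → ℕ → B) →
  map (λ p → f (lookup 𝓡 (proj₁ p)) (toℕ (proj₂ p)))
      (filter (λ p → P? (lookup 𝓡 (proj₁ p)) (toℕ (proj₂ p))) (allPos 𝓡))
  ≡ concatMap (λ w → map (f w) (filter (P? w) (upTo (length w)))) 𝓡
map-filter-allPos 𝓡 P? f = begin
  map F (filter Q? (concatMap positionsIn indices))
    ≡⟨ cong (map F) (filter-concatMap Q? positionsIn indices) ⟩
  map F (concatMap (filter Q? ∘ positionsIn) indices)
    ≡⟨ map-concatMap F (filter Q? ∘ positionsIn) indices ⟩
  concatMap (map F ∘ filter Q? ∘ positionsIn) indices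
    ≡⟨ concatMap-cong perString indices ⟩
  concatMap (H ∘ lookup 𝓡) indices
    ≡⟨ concatMap-map H (lookup 𝓡) indices ⟨
  concatMap H (map (lookup 𝓡) indices)
    ≡⟨ cong (concatMap H) (map-lookup-allFin 𝓡) ⟩
  concatMap H 𝓡 ∎
  where
  open ≡-Reasoning
  indices = allFin (length 𝓡)
  F = λ p → f (lookup 𝓡 (proj₁ p)) (toℕ (proj₂ p))
  Q? = λ p → P? (lookup 𝓡 (proj₁ p)) (toℕ (proj₂ p))
  positionsIn = λ i → map (i ,_) (allFin (length (lookup 𝓡 i)))
  H = λ w → map (f w) (filter (P? w) (upTo (length w)))
  perString : ∀ i → map F (filter Q? (positionsIn i)) ≡ H (lookup 𝓡 i)
  perString i = begin
    map F (filter Q? (map (i ,_) (allFin n)))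
      ≡⟨ map-filter-map F Q? (i ,_) (allFin n) ⟩
    map (f w ∘ toℕ) (filter (P? w ∘ toℕ) (allFin n))
      ≡⟨ map-filter-map (f w) (P? w) toℕ (allFin n) ⟨
    map (f w) (filter (P? w) (map toℕ (allFin n)))
      ≡⟨ cong (map (f w) ∘ filter (P? w)) (map-toℕ-allFin n) ⟩
    H w ∎
    where
    w = lookup 𝓡 i
    n = length w

bwtSym-precedingSym : ∀ 𝓡 i j → bwtSym 𝓡 (i , j) ≡ precedingSym $ (lookup 𝓡 i) (toℕ j)
bwtSym-precedingSym 𝓡 i j with toℕ j
... | zero  = refl
... | suc _ = refl

occurrences : (𝓡 : List (List Sym)) → List Sym → List (Pos 𝓡) → List (Pos 𝓡)
occurrences 𝓡 X = filter (λ p → prefix? X (suffix 𝓡 p))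

πBWTs-concatMap : ∀ 𝓡 Y →
  map (π ∘ bwtSym 𝓡) (occurrences 𝓡 Y (allPos 𝓡)) ≡ concatMap (πBWTsIn Y) 𝓡
πBWTs-concatMap 𝓡 Y =
  trans (map-cong (λ (i , j) → cong π (bwtSym-precedingSym 𝓡 i j)) _)
        (map-filter-allPos 𝓡 (λ w n → prefix? Y (drop n w)) (λ w → π ∘ precedingSym $ w))

rightContexts-concatMap : ∀ 𝓡 Z → rightContexts 𝓡 Z ≡ concatMap (rightContextsIn Z) 𝓡
rightContexts-concatMap 𝓡 Z =
  map-filter-allPos 𝓡 (λ w n → prefix? Z (drop n w)) (λ w n → symAt w (n + length Z))

πBWTRange-occurrences : ∀ 𝓡 SA X s e → IsRange 𝓡 SA X s e →
  πBWTRange 𝓡 SA s e ≡ map (π ∘ bwtSym 𝓡) (occurrences 𝓡 X SA)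
πBWTRange-occurrences 𝓡 SA X s e range = begin
  map (F ∘ lookup SA) (filter inRange? indices)
    ≡⟨ cong (map (F ∘ lookup SA)) (filter-≐ inRange? (X? ∘ lookup SA) inRange≐X indices) ⟩
  map (F ∘ lookup SA) (filter (X? ∘ lookup SA) indices)
    ≡⟨ map-filter-map F X? (lookup SA) indices ⟨
  map F (filter X? (map (lookup SA) indices))
    ≡⟨ cong (map F ∘ filter X?) (map-lookup-allFin SA) ⟩
  map F (filter X? SA) ∎
  where
  open ≡-Reasoning
  indices = allFin (length SA)
  F = π ∘ bwtSym 𝓡
  X? = λ p → prefix? X (suffix 𝓡 p)
  inRange? = λ t → (s ≤? toℕ t) ×-dec (toℕ t ≤? e)
  inRange≐X = (λ {t} → proj₁ (range t)) , (λ {t} → proj₂ (range t))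

πBWTRange-↭-rightContexts : ∀ 𝓧 {Y} → DNAString Y → ∀ {SA} → SA ↭ allPos (collection 𝓧) →
  ∀ {s e} → IsRange (collection 𝓧) SA Y s e →
  πBWTRange (collection 𝓧) SA s e ↭ rightContexts (collection 𝓧) (revcomp Y)
πBWTRange-↭-rightContexts 𝓧 {Y} Y-dna {SA} SA↭allPos {s} {e} range = begin
  πBWTRange 𝓡 SA s e
    ≡⟨ πBWTRange-occurrences 𝓡 SA Y s e range ⟩
  map (π ∘ bwtSym 𝓡) (occurrences 𝓡 Y SA)
    ↭⟨ map⁺ (π ∘ bwtSym 𝓡) (filter-↭ _ SA↭allPos) ⟩
  map (π ∘ bwtSym 𝓡) (occurrences 𝓡 Y (allPos 𝓡))
    ≡⟨ πBWTs-concatMap 𝓡 Y ⟩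
  concatMap (πBWTsIn Y) 𝓡
    ↭⟨ concatMap-collection-↭ πBWTs↭rightContexts 𝓧 ⟩
  concatMap (rightContextsIn (revcomp Y)) 𝓡
    ≡⟨ rightContexts-concatMap 𝓡 (revcomp Y) ⟨
  rightContexts 𝓡 (revcomp Y) ∎
  where
  open PermutationReasoning
  𝓡 = collection 𝓧
  πBWTs↭rightContexts : ∀ R →
    πBWTsIn Y (R ++ [ $ ]) ↭ rightContextsIn (revcomp Y) (revcomp R ++ [ $ ])
  πBWTs↭rightContexts R =
    ↭-trans (↭-reflexive (πBWTsIn-reverse-rightContextsIn Y-dna R)) (↭-reverse _)

lemma1 : (𝓧 : List (List Sym)) → All DNAString 𝓧 →
         (X : List Sym) → DNAString X → Occurs (collection 𝓧) X →
         (SA : List (Pos (collection 𝓧))) → IsSuffixArray (collection 𝓧) SA →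
         (sX eX sXh eXh : ℕ) →
         IsRange (collection 𝓧) SA X sX eX →
         IsRange (collection 𝓧) SA (revcomp X) sXh eXh →
         (sortSyms (πBWTRange (collection 𝓧) SA sX eX)
            ≡ sortSyms (rightContexts (collection 𝓧) (revcomp X)))
         × (sortSyms (πBWTRange (collection 𝓧) SA sXh eXh)
            ≡ sortSyms (rightContexts (collection 𝓧) X))
lemma1 𝓧 _ X X-dna _ SA (SA↭allPos , _) sX eX sXh eXh X-range X̂-range =
  sortSyms-↭ (πBWTRange-↭-rightContexts 𝓧 X-dna SA↭allPos X-range) ,
  sortSyms-↭ (subst (_ ↭_) (cong (rightContexts (collection 𝓧)) (revcomp-involutive X))
                    (πBWTRange-↭-rightContexts 𝓧 (revcomp-DNA X-dna) SA↭allPos X̂-range))
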